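{- (A) Let $K$ be a real quadratic field with associated rank grid $r_{j,m}$ and dimension grid $d_{j,m}$. Then for all positive integers $j,m$: (1) $0<r_{j,m}<\frac{d_{j,m}-1}{2}$; and (2) $(d_j+1)\,r_{j,m}\,(d_{j,m}-r_{j,m})=d_{j,m}^2-1$. (B) Conversely, let $r,d$ be integers such that $0<r<\frac{d-1}{2}$ and $nr(d-r)=d^2-1$ for some integer $n>4$. Then there exist a unique real quadratic field $K$ and unique positive integers $j,m$ such that $r=r_{j,m}$, $d=d_{j,m}$ and $n=d_j+1$, where $r_{j,m}$, $d_{j,m}$, $d_j$ are the grids associated to $K$.
   Context: Let $K\subset\mathbb{R}$ be a real quadratic field of discriminant $\Delta_0$, and let $\varepsilon$ be the smallest unit of $K$ of norm $+1$ that is greater than $1$. For positive integers $j$ set $f_j=(\varepsilon^j-\varepsilon^{ -j})/\sqrt{\Delta_0}$. For positive integers $j,m$ define the rank grid $r_{j,m}=f_{jm}/f_j$, the dimension grid $d_{j,m}=r_{j,m+1}+r_{j,m}$, and $d_j=d_{j,1}$. -}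

module Defs where

open import Data.Nat using (ℕ; zero; suc; _+_; _*_; _/_; _%_; _≤_; _<_)
open import Data.Nat.Divisibility using (_∣_)
open import Data.Product using (_×_; _,_; proj₁; proj₂)
open import Data.Sum using (_⊎_)
open import Relation.Binary.PropositionalEquality using (_≡_)

SquareFree : ℕ → Set
SquareFree m = ∀ p → p * p ∣ m → p ≡ 1

-- Fundamental discriminant of a real quadratic field (Δ > 1).
-- Real quadratic fields K correspond bijectively to such Δ via K = ℚ(√Δ),
-- Δ = disc(K).
RealQuadDisc : ℕ → Set
RealQuadDisc Δ =
  1 < Δ × ((Δ % 4 ≡ 1 × SquareFree Δ)
          ⊎ (Σ' Δ))
  where
  Σ' : ℕ → Set
  Σ' D = Data.Product.Σ ℕ (λ m → D ≡ 4 * m × (m % 4 ≡ 2 ⊎ m % 4 ≡ 3) × SquareFree m)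

-- A unit of norm +1 greater than 1 in O_K is (t + u√Δ)/2 with t,u ≥ 1 and
-- t² - Δu² = 4.  The pair (t,u) represents ε = (t + u√Δ)/2.
NormOneUnit>1 : ℕ → ℕ → ℕ → Set
NormOneUnit>1 Δ t u = 1 ≤ t × 1 ≤ u × t * t ≡ Δ * (u * u) + 4

-- ε is the smallest such unit (among units (t+u√Δ)/2 > 1 of norm 1,
-- the order by size agrees with the order of u, and of t).
IsFundUnit : ℕ → ℕ → ℕ → Set
IsFundUnit Δ t u =
  NormOneUnit>1 Δ t u ×
  (∀ t' u' → NormOneUnit>1 Δ t' u' → t ≤ t' × u ≤ u')

-- Powers of ε = (t + u√Δ)/2, written as ε^j = (a_j + b_j √Δ)/2.
-- Product: ((a + b√Δ)/2)((c + e√Δ)/2) = ((ac + Δbe)/2 + (ae + bc)/2 √Δ)/2.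
-- (The halvings are exact since a ≡ bΔ (mod 2) for elements of O_K.)
εpow : (Δ t u : ℕ) → ℕ → ℕ × ℕ
εpow Δ t u zero = 2 , 0
εpow Δ t u (suc j) =
  let a = proj₁ (εpow Δ t u j) ; b = proj₂ (εpow Δ t u j) in
  (t * a + Δ * (u * b)) / 2 , (t * b + u * a) / 2

-- f_j = (ε^j - ε^{-j})/√Δ.  Since N(ε) = 1, ε^{-j} is the conjugate
-- (a_j - b_j √Δ)/2 of ε^j, hence f_j = b_j.
f : (Δ t u : ℕ) → ℕ → ℕ
f Δ t u j = proj₂ (εpow Δ t u j)

-- division (exact in all uses below; f_j ∣ f_{jm})
_div_ : ℕ → ℕ → ℕ
m div zero = 0
m div suc n = m / suc n

r : (Δ t u : ℕ) → ℕ → ℕ → ℕ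
r Δ t u j m = f Δ t u (j * m) div f Δ t u j

dg : (Δ t u : ℕ) → ℕ → ℕ → ℕ
dg Δ t u j m = r Δ t u j (suc m) + r Δ t u j m

d₁ : (Δ t u : ℕ) → ℕ → ℕ
d₁ Δ t u j = dg Δ t u j 1

module Submission where

-- Write ε = (t + u √Δ)/2 and εʲ = (a_j + b_j √Δ)/2, so that f_j = b_j.  As εʲ has norm 1 and
-- trace a_j, (εʲ)² = a_j εʲ − 1, hence f_{j(m+2)} + f_{jm} = a_j f_{j(m+1)}: the row m ↦ r_{j,m} is the
-- Lucas sequence U_m(a_j, 1), and d_j = a_j + 1.  Consecutive terms x = U_m, y = U_{m+1} solve
-- x² + y² = a_j x y + 1, which for r = x, d = x + y is the identity (d_j + 1) r (d − r) = d² − 1 of (A).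
-- Conversely, with a = n − 2, Vieta jumping shows that every solution with x + 1 < y is such a pair
-- (U_m, U_{m+1}); writing a² − 4 = Δ f² with Δ a fundamental discriminant (unique, by comparing
-- square-free parts) determines K, and (a + f √Δ)/2 is a power εʲ of the fundamental unit (divide
-- by ε until f vanishes), with j unique since a_j increases with j.

open import Defs
open import Data.Nat as ℕ using (ℕ; zero; suc; z≤n; s≤s; z<s)
import Data.Nat.Properties as ℕ
import Data.Nat.Tactic.RingSolver as ℕ-Solver
open import Data.List using ([]; _∷_)
open import Data.Product using (Σ; ∃; ∃₂; _×_; _,_; proj₁; proj₂)
open import Relation.Binary.PropositionalEquality

module Arithmetic where

  open import Data.Nat
  open import Data.Nat.Properties
  open import Data.Nat.Divisibility using (_∣_; ∣-refl; ∣m∣n⇒∣m+n; ∣m+n∣m⇒∣n; n∣m*n; divides)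
  open import Data.Nat.Induction using (<-rec)
  open import Data.Nat.Tactic.RingSolver using (solve-∀)
  open import Data.Parity.Base using (0ℙ)
  open import Data.Sum using (inj₁; inj₂)
  open import Relation.Binary.Definitions using (tri<; tri≈; tri>)
  open import Relation.Nullary using (Dec; yes; no; contradiction)
  open import Relation.Unary using (Pred; Decidable)

  m*m≤n*n⇒m≤n : ∀ m n → m * m ≤ n * n → m ≤ n
  m*m≤n*n⇒m≤n m n m*m≤n*n = ≮⇒≥ λ n<m → <⇒≱ (*-mono-< n<m n<m) m*m≤n*n

  m*m<n*n⇒m<n : ∀ m n → m * m < n * n → m < n
  m*m<n*n⇒m<n m n m*m<n*n = ≰⇒> λ n≤m → <⇒≱ m*m<n*n (*-mono-≤ n≤m n≤m)

  module _ {f : ℕ → ℕ} (f-<-suc : ∀ n → f n < f (suc n)) where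

    <-suc⇒strictMono : ∀ {m n} → m < n → f m < f n
    <-suc⇒strictMono {m} {suc n} m<1+n with m≤n⇒m<n∨m≡n (s≤s⁻¹ m<1+n)
    ... | inj₁ m<n  = <-trans (<-suc⇒strictMono m<n) (f-<-suc n)
    ... | inj₂ refl = f-<-suc n

    <-suc⇒injective : ∀ {m n} → f m ≡ f n → m ≡ n
    <-suc⇒injective {m} {n} fm≡fn with <-cmp m n
    ... | tri< m<n _ _ = contradiction fm≡fn (<⇒≢ (<-suc⇒strictMono m<n))
    ... | tri≈ _ m≡n _ = m≡n
    ... | tri> _ _ n<m = contradiction (sym fm≡fn) (<⇒≢ (<-suc⇒strictMono n<m))

  module _ {p} {P : Pred ℕ p} (P? : Decidable P) where

    least : ∀ n → P n → ∃ λ m → P m × (∀ k → P k → m ≤ k)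
    least = <-rec (λ n → P n → ∃ λ m → P m × (∀ k → P k → m ≤ k)) step
      where
      step : ∀ n → (∀ {m} → m < n → P m → ∃ λ k → P k × (∀ l → P l → k ≤ l)) →
             P n → ∃ λ m → P m × (∀ k → P k → m ≤ k)
      step n rec Pn with anyUpTo? P? n
      ... | yes (m , m<n , Pm) = rec m<n Pm
      ... | no ∄m<n = n , Pn , λ k Pk → ≮⇒≥ λ k<n → ∄m<n (k , k<n , Pk)

  parity≡0ℙ⇒2∣ : ∀ n → parity n ≡ 0ℙ → 2 ∣ n
  parity≡0ℙ⇒2∣ zero          _  = divides 0 refl
  parity≡0ℙ⇒2∣ (suc zero)    ()
  parity≡0ℙ⇒2∣ (suc (suc n)) eq = ∣m∣n⇒∣m+n (∣-refl {2}) (parity≡0ℙ⇒2∣ n eq)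

  m≤m*m : ∀ m → m ≤ m * m
  m≤m*m zero    = z≤n
  m≤m*m (suc m) = m≤m*n (suc m) (suc m)

  m*m≡n*n⇒m≡n : ∀ m n → m * m ≡ n * n → m ≡ n
  m*m≡n*n⇒m≡n m n eq = ≤-antisym (m*m≤n*n⇒m≤n m n (≤-reflexive eq)) (m*m≤n*n⇒m≤n n m (≤-reflexive (sym eq)))

  square? : ∀ n → Dec (∃ λ m → m * m ≡ n)
  square? n with anyUpTo? (λ m → m * m ≟ n) (suc n)
  ... | yes (m , _ , m*m≡n) = yes (m , m*m≡n)
  ... | no ∄m               = no λ (m , m*m≡n) → ∄m (m , s≤s (subst (m ≤_) m*m≡n (m≤m*m m)) , m*m≡n)

  2∣m+n⇒2∣m∸n : ∀ {m n} → n ≤ m → 2 ∣ m + n → 2 ∣ m ∸ n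
  2∣m+n⇒2∣m∸n {m} {n} n≤m 2∣m+n = ∣m+n∣m⇒∣n (subst (2 ∣_) m+n≡n*2+[m∸n] 2∣m+n) (n∣m*n n)
    where
    k+n+n≡n*2+k : ∀ k n → k + n + n ≡ n * 2 + k
    k+n+n≡n*2+k = solve-∀
    m+n≡n*2+[m∸n] : m + n ≡ n * 2 + (m ∸ n)
    m+n≡n*2+[m∸n] = trans (cong (_+ n) (sym (m∸n+n≡m n≤m))) (k+n+n≡n*2+k (m ∸ n) n)

  half-pos : ∀ {x n} → 2 * x ≡ n → 0 < n → 0 < x
  half-pos {x} 2x≡n 0<n = *-cancelˡ-< 2 0 x (subst (0 <_) (sym 2x≡n) 0<n)

module Lucas where

  open import Data.Nat
  open import Data.Nat.Properties
  open import Data.Nat.Induction using (<-rec)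
  open import Data.Nat.Tactic.RingSolver using (solve)
  open import Function.Bundles using (_⇔_; mk⇔)
  open import Relation.Nullary using (¬_)
  open Arithmetic

  -- The Lucas sequence U_m(a, 1); the truncated subtraction is exact when 2 ≤ a.
  lucasU : ℕ → ℕ → ℕ
  lucasU a zero          = 0
  lucasU a (suc zero)    = 1
  lucasU a (suc (suc m)) = a * lucasU a (suc m) ∸ lucasU a m

  lucasU-2 : ∀ a → lucasU a 2 ≡ a
  lucasU-2 a = *-identityʳ a

  Markov : ℕ → ℕ → ℕ → Set
  Markov a x y = x * x + y * y ≡ a * x * y + 1

  module _ (a : ℕ) where

    markov-sym : ∀ x y → Markov a x y → Markov a y x
    markov-sym x y eq = begin
      y * y + x * x   ≡⟨ +-comm (y * y) (x * x) ⟩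
      x * x + y * y   ≡⟨ eq ⟩
      a * x * y + 1   ≡⟨ cong (_+ 1) (solve (a ∷ x ∷ y ∷ [])) ⟩
      a * y * x + 1   ∎
      where open ≡-Reasoning

    markov⇒roots-product : ∀ x y z → z + x ≡ a * y → Markov a x y → y * y ≡ x * z + 1
    markov⇒roots-product x y z z+x≡ay eq = +-cancelˡ-≡ (x * x) _ _ (begin
      x * x + y * y       ≡⟨ eq ⟩
      a * x * y + 1       ≡⟨ solve (a ∷ x ∷ y ∷ []) ⟩
      x * (a * y) + 1     ≡⟨ cong (λ w → x * w + 1) z+x≡ay ⟨
      x * (z + x) + 1     ≡⟨ solve (x ∷ z ∷ []) ⟩
      x * x + (x * z + 1) ∎)
      where open ≡-Reasoning

    markov-jump : ∀ x y z → z + x ≡ a * y → Markov a x y → Markov a y z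
    markov-jump x y z z+x≡ay eq = begin
      y * y + z * z      ≡⟨ cong (_+ z * z) (markov⇒roots-product x y z z+x≡ay eq) ⟩
      x * z + 1 + z * z  ≡⟨ solve (x ∷ z ∷ []) ⟩
      z * (z + x) + 1    ≡⟨ cong (λ w → z * w + 1) z+x≡ay ⟩
      z * (a * y) + 1    ≡⟨ solve (a ∷ y ∷ z ∷ []) ⟩
      a * y * z + 1      ∎
      where open ≡-Reasoning

    markov⇔square : ∀ x y → Markov a x y ⇔ ((a + 2) * x * y + 1 ≡ (y + x) * (y + x))
    markov⇔square x y = mk⇔
      (λ eq → begin
        (a + 2) * x * y + 1          ≡⟨ solve (a ∷ x ∷ y ∷ []) ⟩
        a * x * y + 1 + 2 * x * y    ≡⟨ cong (_+ 2 * x * y) eq ⟨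
        x * x + y * y + 2 * x * y    ≡⟨ solve (x ∷ y ∷ []) ⟩
        (y + x) * (y + x)            ∎)
      (λ eq → +-cancelʳ-≡ (2 * x * y) _ _ (begin
        x * x + y * y + 2 * x * y    ≡⟨ solve (x ∷ y ∷ []) ⟩
        (y + x) * (y + x)            ≡⟨ eq ⟨
        (a + 2) * x * y + 1          ≡⟨ solve (a ∷ x ∷ y ∷ []) ⟩
        a * x * y + 1 + 2 * x * y    ∎))
      where open ≡-Reasoning

    markov[1,y]⇒y≡a : ∀ y → 0 < y → Markov a 1 y → y ≡ a
    markov[1,y]⇒y≡a y@(suc _) _ eq = *-cancelʳ-≡ y a y (suc-injective (begin
      suc (y * y)       ≡⟨ eq ⟩
      a * 1 * y + 1     ≡⟨ cong (λ w → w * y + 1) (*-identityʳ a) ⟩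
      a * y + 1         ≡⟨ +-comm (a * y) 1 ⟩
      suc (a * y)       ∎))
      where open ≡-Reasoning

    markov⇒y≤a*x : ∀ x y → 1 < y → Markov a x y → y ≤ a * x
    markov⇒y≤a*x x y 1<y eq = ≮⇒≥ λ ax<y → <-irrefl refl (begin-strict
      a * x * y + 1     <⟨ +-monoʳ-< (a * x * y) 1<y ⟩
      a * x * y + y     ≡⟨ +-comm (a * x * y) y ⟩
      suc (a * x) * y   ≤⟨ *-monoˡ-≤ y ax<y ⟩
      y * y             ≤⟨ m≤n+m (y * y) (x * x) ⟩
      x * x + y * y     ≡⟨ eq ⟩
      a * x * y + 1     ∎)
      where open ≤-Reasoning

    -- Vieta jumping: the other root z = a x − y of the quadratic in y gives the smaller solution (z, x).
    markov-descent : ∀ x y → 1 < x → x + 1 < y → Markov a x y →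
                     ∃ λ z → z + y ≡ a * x × 0 < z × z + 1 < x × Markov a z x
    markov-descent (suc zero) _ (s≤s ()) _ _
    markov-descent x@(suc x′@(suc x″)) y _ x+1<y eq = z , z+y≡ax , 0<z , z+1<x , markov-z-x
      where
      z = a * x ∸ y
      z+y≡ax : z + y ≡ a * x
      z+y≡ax = m∸n+n≡m (markov⇒y≤a*x x y (≤-trans (s≤s (s≤s z≤n)) (<⇒≤ x+1<y)) eq)
      markov-z-x : Markov a z x
      markov-z-x = markov-sym x z (markov-jump y x z z+y≡ax (markov-sym x y eq))
      x*x≡y*z+1 : x * x ≡ y * z + 1
      x*x≡y*z+1 = markov⇒roots-product y x z z+y≡ax (markov-sym x y eq)
      0<z : 0 < z
      0<z = n≢0⇒n>0 λ z≡0 → 1+n≢0 (suc-injective (begin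
        x * x       ≡⟨ x*x≡y*z+1 ⟩
        y * z + 1   ≡⟨ cong (λ w → y * w + 1) z≡0 ⟩
        y * 0 + 1   ≡⟨ cong (_+ 1) (*-zeroʳ y) ⟩
        1           ∎))
        where open ≡-Reasoning
      z+1<x : z + 1 < x
      z+1<x = ≰⇒> x≰z+1
        where
        x≰z+1 : ¬ x ≤ z + 1
        x≰z+1 x≤z+1 = <-irrefl refl (begin-strict
          x * x                      ≡⟨ solve (x″ ∷ []) ⟩
          x′ * x′ + 2 * x′ + 1       <⟨ +-monoˡ-< 1 (+-monoʳ-< (x′ * x′) (*-monoˡ-< x′ {2} {3} ≤-refl)) ⟩
          x′ * x′ + 3 * x′ + 1       ≡⟨ solve (x″ ∷ []) ⟩
          (x′ + 3) * x′ + 1          ≤⟨ +-monoˡ-≤ 1 (*-mono-≤ x′+3≤y x′≤z) ⟩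
          y * z + 1                  ≡⟨ x*x≡y*z+1 ⟨
          x * x                      ∎)
          where
          open ≤-Reasoning
          x′≤z : x′ ≤ z
          x′≤z = ≤-pred (subst (x ≤_) (+-comm z 1) x≤z+1)
          x′+3≤y : x′ + 3 ≤ y
          x′+3≤y = begin
            x′ + 3        ≡⟨ solve (x″ ∷ []) ⟩
            suc (x + 1)   ≤⟨ x+1<y ⟩
            y             ∎

  module _ {a} (2≤a : 2 ≤ a) where

    private
      m+m≤a*m : ∀ m → m + m ≤ a * m
      m+m≤a*m m = subst (_≤ a * m) (cong (m +_) (+-identityʳ m)) (*-monoˡ-≤ m 2≤a)

    lucasU-<-suc : ∀ m → lucasU a m < lucasU a (suc m)
    lucasU-<-suc zero    = s≤s z≤n
    lucasU-<-suc (suc m) = m+n≤o⇒m≤o∸n (suc (lucasU a (suc m)))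
      (≤-trans (+-monoʳ-< (lucasU a (suc m)) (lucasU-<-suc m)) (m+m≤a*m (lucasU a (suc m))))

    lucasU-rec : ∀ m → lucasU a (2 + m) + lucasU a m ≡ a * lucasU a (suc m)
    lucasU-rec m = m∸n+n≡m
      (≤-trans (<⇒≤ (lucasU-<-suc m)) (≤-trans (m≤m+n _ _) (m+m≤a*m (lucasU a (suc m)))))

    lucasU-pos : ∀ m → 0 < lucasU a (suc m)
    lucasU-pos m = ≤-<-trans z≤n (lucasU-<-suc m)

    lucasU-injective : ∀ {m n} → lucasU a m ≡ lucasU a n → m ≡ n
    lucasU-injective = <-suc⇒injective lucasU-<-suc

    markov-lucasU : ∀ m → Markov a (lucasU a m) (lucasU a (suc m))
    markov-lucasU zero    = cong (λ w → w * 1 + 1) (sym (*-zeroʳ a))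
    markov-lucasU (suc m) = markov-jump a (lucasU a m) (lucasU a (suc m)) (lucasU a (2 + m)) (lucasU-rec m) (markov-lucasU m)

    lucasU-gap : 3 ≤ a → ∀ m → lucasU a (suc m) + 1 < lucasU a (2 + m)
    lucasU-gap 3≤a m = begin-strict
      Y + 1     ≤⟨ +-monoʳ-≤ Y (lucasU-pos m) ⟩
      Y + Y     <⟨ +-cancelʳ-< Y (Y + Y) Z 3Y<Z+Y ⟩
      Z         ∎
      where
      open ≤-Reasoning
      X = lucasU a m
      Y = lucasU a (suc m)
      Z = lucasU a (2 + m)
      3Y<Z+Y : Y + Y + Y < Z + Y
      3Y<Z+Y = begin-strict
        Y + Y + Y   ≡⟨ +-assoc Y Y Y ⟩
        Y + (Y + Y) ≡⟨ cong (λ w → Y + (Y + w)) (+-identityʳ Y) ⟨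
        3 * Y       ≤⟨ *-monoˡ-≤ Y 3≤a ⟩
        a * Y       ≡⟨ lucasU-rec m ⟨
        Z + X       <⟨ +-monoʳ-< Z (lucasU-<-suc m) ⟩
        Z + Y       ∎

    markov⇒lucasU : ∀ x y → 0 < x → x + 1 < y → Markov a x y →
                    ∃ λ m → lucasU a (suc m) ≡ x × lucasU a (2 + m) ≡ y
    markov⇒lucasU = <-rec _ step
      where
      step : ∀ x → (∀ {z} → z < x → ∀ y → 0 < z → z + 1 < y → Markov a z y →
                     ∃ λ m → lucasU a (suc m) ≡ z × lucasU a (2 + m) ≡ y) →
             ∀ y → 0 < x → x + 1 < y → Markov a x y →
             ∃ λ m → lucasU a (suc m) ≡ x × lucasU a (2 + m) ≡ y
      step (suc zero) _ y _ 2<y eq =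
        0 , refl , trans (lucasU-2 a) (sym (markov[1,y]⇒y≡a a y (≤-trans (s≤s z≤n) 2<y) eq))
      step x@(suc (suc _)) rec y _ x+1<y eq with markov-descent a x y (s≤s (s≤s z≤n)) x+1<y eq
      ... | z , z+y≡ax , 0<z , z+1<x , eq′ with rec (<-trans (m<m+n z z<s) z+1<x) x 0<z z+1<x eq′
      ...   | m , U₁≡z , U₂≡x = suc m , U₂≡x , +-cancelʳ-≡ z _ _ (begin
        lucasU a (3 + m) + z                  ≡⟨ cong (lucasU a (3 + m) +_) U₁≡z ⟨
        lucasU a (3 + m) + lucasU a (suc m)   ≡⟨ lucasU-rec (suc m) ⟩
        a * lucasU a (2 + m)                  ≡⟨ cong (a *_) U₂≡x ⟩
        a * x                                 ≡⟨ z+y≡ax ⟨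
        z + y                                 ≡⟨ +-comm z y ⟩
        y + z                                 ∎)
        where open ≡-Reasoning

module QuadraticUnits where

  open import Data.Nat
  open import Data.Nat.Properties
  open import Data.Nat.DivMod using (m*[n/m]≡n; m*n/n≡m)
  open import Data.Nat.Divisibility using (_∣_)
  open import Data.Nat.Induction using (<-rec)
  open import Data.Nat.Tactic.RingSolver using (solve)
  open import Data.Parity.Base as ℙ using (0ℙ; 1ℙ)
  import Data.Parity.Properties as ℙₚ
  open import Relation.Nullary using (Dec; _×-dec_)
  open Arithmetic
  open Lucas

  NormOne : ℕ → ℕ → ℕ → Set
  NormOne Δ x y = x * x ≡ Δ * (y * y) + 4

  -- (x + y √Δ)/2 = ((t + u √Δ)/2) · ((p + q √Δ)/2).
  record IsProduct (Δ t u p q x y : ℕ) : Set where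
    constructor isProduct
    field
      fst : 2 * x ≡ t * p + Δ * (u * q)
      snd : 2 * y ≡ t * q + u * p

  module _ {Δ t u p q x y : ℕ} (prod : IsProduct Δ t u p q x y) where

    open IsProduct prod

    isProduct-norm : NormOne Δ t u → x * x + Δ * (q * q) ≡ Δ * (y * y) + p * p
    isProduct-norm ε-norm = *-cancelˡ-≡ _ _ 4 (begin
      4 * (x * x + Δ * (q * q))
        ≡⟨ solve (x ∷ Δ ∷ q ∷ []) ⟩
      (2 * x) * (2 * x) + 4 * (Δ * (q * q))
        ≡⟨ cong (λ w → w * w + 4 * (Δ * (q * q))) fst ⟩
      (t * p + Δ * (u * q)) * (t * p + Δ * (u * q)) + 4 * (Δ * (q * q))
        ≡⟨ solve (t ∷ p ∷ Δ ∷ u ∷ q ∷ []) ⟩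
      (t * t) * (p * p) + (2 * (t * p) * (Δ * (u * q)) + Δ * Δ * (u * u) * (q * q) + 4 * (Δ * (q * q)))
        ≡⟨ cong₂ _+_ (cong (_* (p * p)) ε-norm) refl ⟩
      (Δ * (u * u) + 4) * (p * p) + (2 * (t * p) * (Δ * (u * q)) + Δ * Δ * (u * u) * (q * q) + 4 * (Δ * (q * q)))
        ≡⟨ solve (t ∷ p ∷ Δ ∷ u ∷ q ∷ []) ⟩
      Δ * ((Δ * (u * u) + 4) * (q * q)) + (2 * (t * p) * (Δ * (u * q)) + Δ * (u * u) * (p * p) + 4 * (p * p))
        ≡⟨ cong₂ _+_ (cong (λ w → Δ * (w * (q * q))) ε-norm) refl ⟨
      Δ * ((t * t) * (q * q)) + (2 * (t * p) * (Δ * (u * q)) + Δ * (u * u) * (p * p) + 4 * (p * p))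
        ≡⟨ solve (t ∷ p ∷ Δ ∷ u ∷ q ∷ []) ⟩
      Δ * ((t * q + u * p) * (t * q + u * p)) + 4 * (p * p)
        ≡⟨ cong (λ w → Δ * (w * w) + 4 * (p * p)) snd ⟨
      Δ * ((2 * y) * (2 * y)) + 4 * (p * p)
        ≡⟨ solve (Δ ∷ y ∷ p ∷ []) ⟩
      4 * (Δ * (y * y) + p * p) ∎)
      where open ≡-Reasoning

    isProduct-normOne : NormOne Δ t u → NormOne Δ p q → NormOne Δ x y
    isProduct-normOne ε-norm pq-norm = +-cancelʳ-≡ (Δ * (q * q)) _ _ (begin
      x * x + Δ * (q * q)               ≡⟨ isProduct-norm ε-norm ⟩
      Δ * (y * y) + p * p               ≡⟨ cong (Δ * (y * y) +_) pq-norm ⟩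
      Δ * (y * y) + (Δ * (q * q) + 4)   ≡⟨ solve (Δ ∷ y ∷ q ∷ []) ⟩
      Δ * (y * y) + 4 + Δ * (q * q)     ∎)
      where open ≡-Reasoning

    isProduct-normOne⁻¹ : NormOne Δ t u → NormOne Δ x y → NormOne Δ p q
    isProduct-normOne⁻¹ ε-norm xy-norm = +-cancelˡ-≡ (Δ * (y * y)) _ _ (begin
      Δ * (y * y) + p * p               ≡⟨ isProduct-norm ε-norm ⟨
      x * x + Δ * (q * q)               ≡⟨ cong (_+ Δ * (q * q)) xy-norm ⟩
      Δ * (y * y) + 4 + Δ * (q * q)     ≡⟨ solve (Δ ∷ y ∷ q ∷ []) ⟩
      Δ * (y * y) + (Δ * (q * q) + 4)   ∎)
      where open ≡-Reasoning

  normOne⇒parity : ∀ Δ x y → NormOne Δ x y → parity x ≡ parity Δ ℙ.* parity y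
  normOne⇒parity Δ x y eq = begin
    parity x                              ≡⟨ ℙₚ.*-idem (parity x) ⟨
    parity x ℙ.* parity x                 ≡⟨ ℙₚ.*-homo-* x x ⟨
    parity (x * x)                        ≡⟨ cong parity eq ⟩
    parity (Δ * (y * y) + 4)              ≡⟨ ℙₚ.+-homo-+ (Δ * (y * y)) 4 ⟩
    parity (Δ * (y * y)) ℙ.+ 0ℙ           ≡⟨ ℙₚ.+-identityʳ _ ⟩
    parity (Δ * (y * y))                  ≡⟨ ℙₚ.*-homo-* Δ (y * y) ⟩
    parity Δ ℙ.* parity (y * y)           ≡⟨ cong (parity Δ ℙ.*_) (ℙₚ.*-homo-* y y) ⟩
    parity Δ ℙ.* (parity y ℙ.* parity y)  ≡⟨ cong (parity Δ ℙ.*_) (ℙₚ.*-idem (parity y)) ⟩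
    parity Δ ℙ.* parity y                 ∎
    where open ≡-Reasoning

  -- Both coordinates of a product of norm-one elements are even, since x ≡ Δ y (mod 2) for each factor.
  normOne-product-even : ∀ Δ t u p q → NormOne Δ t u → NormOne Δ p q →
                         2 ∣ t * p + Δ * (u * q) × 2 ∣ t * q + u * p
  normOne-product-even Δ t u p q tu-norm pq-norm = parity≡0ℙ⇒2∣ _ fst-even , parity≡0ℙ⇒2∣ _ snd-even
    where
    open ≡-Reasoning
    D = parity Δ
    U = parity u
    Q = parity q
    parity-t : parity t ≡ D ℙ.* U
    parity-t = normOne⇒parity Δ t u tu-norm
    parity-p : parity p ≡ D ℙ.* Q
    parity-p = normOne⇒parity Δ p q pq-norm
    fst-even : parity (t * p + Δ * (u * q)) ≡ 0ℙ
    fst-even = begin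
      parity (t * p + Δ * (u * q))
        ≡⟨ ℙₚ.+-homo-+ (t * p) (Δ * (u * q)) ⟩
      parity (t * p) ℙ.+ parity (Δ * (u * q))
        ≡⟨ cong₂ ℙ._+_ (ℙₚ.*-homo-* t p) (trans (ℙₚ.*-homo-* Δ (u * q)) (cong (D ℙ.*_) (ℙₚ.*-homo-* u q))) ⟩
      (parity t ℙ.* parity p) ℙ.+ (D ℙ.* (U ℙ.* Q))
        ≡⟨ cong₂ (λ t′ p′ → (t′ ℙ.* p′) ℙ.+ (D ℙ.* (U ℙ.* Q))) parity-t parity-p ⟩
      ((D ℙ.* U) ℙ.* (D ℙ.* Q)) ℙ.+ (D ℙ.* (U ℙ.* Q))
        ≡⟨ vanishes D U Q ⟩
      0ℙ ∎
      where
      vanishes : ∀ d u q → ((d ℙ.* u) ℙ.* (d ℙ.* q)) ℙ.+ (d ℙ.* (u ℙ.* q)) ≡ 0ℙ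
      vanishes 0ℙ _ _ = refl
      vanishes 1ℙ u q = ℙₚ.p+p≡0ℙ (u ℙ.* q)
    snd-even : parity (t * q + u * p) ≡ 0ℙ
    snd-even = begin
      parity (t * q + u * p)
        ≡⟨ ℙₚ.+-homo-+ (t * q) (u * p) ⟩
      parity (t * q) ℙ.+ parity (u * p)
        ≡⟨ cong₂ ℙ._+_ (ℙₚ.*-homo-* t q) (ℙₚ.*-homo-* u p) ⟩
      (parity t ℙ.* Q) ℙ.+ (U ℙ.* parity p)
        ≡⟨ cong₂ (λ t′ p′ → (t′ ℙ.* Q) ℙ.+ (U ℙ.* p′)) parity-t parity-p ⟩
      ((D ℙ.* U) ℙ.* Q) ℙ.+ (U ℙ.* (D ℙ.* Q))
        ≡⟨ vanishes D U Q ⟩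
      0ℙ ∎
      where
      vanishes : ∀ d u q → ((d ℙ.* u) ℙ.* q) ℙ.+ (u ℙ.* (d ℙ.* q)) ≡ 0ℙ
      vanishes 0ℙ 0ℙ _ = refl
      vanishes 0ℙ 1ℙ _ = refl
      vanishes 1ℙ u  q = ℙₚ.p+p≡0ℙ (u ℙ.* q)

  module _ {Δ t u a₁ a₂ b₁ b₂ c₁ c₂ d₁ d₂ e₁ e₂ : ℕ} where

    -- With ε = (t + u √Δ)/2, α = (a₁ + a₂ √Δ)/2, β = (b₁ + b₂ √Δ)/2: ε (α β) = α (ε β).
    isProduct-assoc : IsProduct Δ t u c₁ c₂ d₁ d₂ → IsProduct Δ a₁ a₂ b₁ b₂ c₁ c₂ →
                      IsProduct Δ t u b₁ b₂ e₁ e₂ → IsProduct Δ a₁ a₂ e₁ e₂ d₁ d₂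
    isProduct-assoc (isProduct d₁≡ d₂≡) (isProduct c₁≡ c₂≡) (isProduct e₁≡ e₂≡) = isProduct
      (*-cancelˡ-≡ _ _ 2 (begin
        2 * (2 * d₁)                                           ≡⟨ cong (2 *_) d₁≡ ⟩
        2 * (t * c₁ + Δ * (u * c₂))                            ≡⟨ solve (t ∷ c₁ ∷ Δ ∷ u ∷ c₂ ∷ []) ⟩
        t * (2 * c₁) + Δ * (u * (2 * c₂))                      ≡⟨ cong₂ (λ x y → t * x + Δ * (u * y)) c₁≡ c₂≡ ⟩
        t * (a₁ * b₁ + Δ * (a₂ * b₂)) + Δ * (u * (a₁ * b₂ + a₂ * b₁))
                                                               ≡⟨ solve (t ∷ u ∷ Δ ∷ a₁ ∷ a₂ ∷ b₁ ∷ b₂ ∷ []) ⟩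
        a₁ * (t * b₁ + Δ * (u * b₂)) + Δ * (a₂ * (t * b₂ + u * b₁))
                                                               ≡⟨ cong₂ (λ x y → a₁ * x + Δ * (a₂ * y)) e₁≡ e₂≡ ⟨
        a₁ * (2 * e₁) + Δ * (a₂ * (2 * e₂))                    ≡⟨ solve (a₁ ∷ e₁ ∷ Δ ∷ a₂ ∷ e₂ ∷ []) ⟩
        2 * (a₁ * e₁ + Δ * (a₂ * e₂))                          ∎))
      (*-cancelˡ-≡ _ _ 2 (begin
        2 * (2 * d₂)                                           ≡⟨ cong (2 *_) d₂≡ ⟩
        2 * (t * c₂ + u * c₁)                                  ≡⟨ solve (t ∷ c₁ ∷ u ∷ c₂ ∷ []) ⟩
        t * (2 * c₂) + u * (2 * c₁)                            ≡⟨ cong₂ (λ x y → t * x + u * y) c₂≡ c₁≡ ⟩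
        t * (a₁ * b₂ + a₂ * b₁) + u * (a₁ * b₁ + Δ * (a₂ * b₂))
                                                               ≡⟨ solve (t ∷ u ∷ Δ ∷ a₁ ∷ a₂ ∷ b₁ ∷ b₂ ∷ []) ⟩
        a₁ * (t * b₂ + u * b₁) + a₂ * (t * b₁ + Δ * (u * b₂))  ≡⟨ cong₂ (λ x y → a₁ * x + a₂ * y) e₂≡ e₁≡ ⟨
        a₁ * (2 * e₂) + a₂ * (2 * e₁)                          ≡⟨ solve (a₁ ∷ e₁ ∷ a₂ ∷ e₂ ∷ []) ⟩
        2 * (a₁ * e₂ + a₂ * e₁)                                ∎))
      where open ≡-Reasoning

  module _ {Δ t u a₁ a₂ b₁ b₂ c₁ c₂ : ℕ} where

    -- Cayley–Hamilton for ε = (t + u √Δ)/2, of norm 1 and trace t: ε² α + α = t ε α.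
    isProduct-trace : NormOne Δ t u → IsProduct Δ t u a₁ a₂ b₁ b₂ → IsProduct Δ t u b₁ b₂ c₁ c₂ →
                      c₂ + a₂ ≡ t * b₂
    isProduct-trace ε-norm (isProduct b₁≡ b₂≡) (isProduct _ c₂≡) = *-cancelˡ-≡ _ _ 4 (begin
      4 * (c₂ + a₂)                                          ≡⟨ solve (c₂ ∷ a₂ ∷ []) ⟩
      2 * (2 * c₂) + 4 * a₂                                  ≡⟨ cong (λ x → 2 * x + 4 * a₂) c₂≡ ⟩
      2 * (t * b₂ + u * b₁) + 4 * a₂                         ≡⟨ solve (t ∷ b₂ ∷ u ∷ b₁ ∷ a₂ ∷ []) ⟩
      t * (2 * b₂) + u * (2 * b₁) + 4 * a₂                   ≡⟨ cong₂ (λ x y → t * x + u * y + 4 * a₂) b₂≡ b₁≡ ⟩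
      t * (t * a₂ + u * a₁) + u * (t * a₁ + Δ * (u * a₂)) + 4 * a₂
                                                             ≡⟨ solve (t ∷ u ∷ Δ ∷ a₁ ∷ a₂ ∷ []) ⟩
      t * t * a₂ + 2 * (t * (u * a₁)) + (Δ * (u * u) + 4) * a₂
                                                             ≡⟨ cong (λ x → t * t * a₂ + 2 * (t * (u * a₁)) + x * a₂) ε-norm ⟨
      t * t * a₂ + 2 * (t * (u * a₁)) + t * t * a₂           ≡⟨ solve (t ∷ u ∷ a₁ ∷ a₂ ∷ []) ⟩
      2 * t * (t * a₂ + u * a₁)                              ≡⟨ cong (2 * t *_) b₂≡ ⟨
      2 * t * (2 * b₂)                                       ≡⟨ solve (t ∷ b₂ ∷ []) ⟩
      4 * (t * b₂)                                           ∎)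
      where open ≡-Reasoning

  isProduct-by-one : ∀ Δ x y → IsProduct Δ x y 2 0 x y
  isProduct-by-one Δ x y = isProduct (solve (x ∷ Δ ∷ y ∷ [])) (solve (x ∷ y ∷ []))

  m*n-div-n≡m : ∀ m n → 0 < n → (m * n) div n ≡ m
  m*n-div-n≡m m (suc n) _ = m*n/n≡m m (suc n)

  module Powers (Δ t u : ℕ) (ε-norm : NormOne Δ t u) where

    a : ℕ → ℕ
    a j = proj₁ (εpow Δ t u j)

    b : ℕ → ℕ
    b = f Δ t u

    normOne-pow : ∀ j → NormOne Δ (a j) (b j)
    isProduct-suc : ∀ j → IsProduct Δ t u (a j) (b j) (a (suc j)) (b (suc j))

    normOne-pow zero    = cong (_+ 4) (sym (*-zeroʳ Δ))
    normOne-pow (suc j) = isProduct-normOne (isProduct-suc j) ε-norm (normOne-pow j)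

    isProduct-suc j = isProduct (m*[n/m]≡n (proj₁ even)) (m*[n/m]≡n (proj₂ even))
      where even = normOne-product-even Δ t u (a j) (b j) ε-norm (normOne-pow j)

    isProduct-+ : ∀ k j → IsProduct Δ (a k) (b k) (a j) (b j) (a (k + j)) (b (k + j))
    isProduct-+ k zero    = subst (λ i → IsProduct Δ (a k) (b k) 2 0 (a i) (b i)) (sym (+-identityʳ k))
      (isProduct-by-one Δ (a k) (b k))
    isProduct-+ k (suc j) = subst (λ i → IsProduct Δ (a k) (b k) (a (suc j)) (b (suc j)) (a i) (b i)) (sym (+-suc k j))
      (isProduct-assoc (isProduct-suc (k + j)) (isProduct-+ k j) (isProduct-suc j))

    b-trace : ∀ j i → b (j + (j + i)) + b i ≡ a j * b (j + i)
    b-trace j i = isProduct-trace (normOne-pow j) (isProduct-+ j i) (isProduct-+ j (j + i))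

    b-* : ∀ j → 2 ≤ a j → ∀ m → b (j * m) ≡ lucasU (a j) m * b j
    b-* j 2≤a zero          = cong b (*-zeroʳ j)
    b-* j 2≤a (suc zero)    = trans (cong b (*-identityʳ j)) (sym (+-identityʳ (b j)))
    b-* j 2≤a (suc (suc m)) = +-cancelʳ-≡ (lucasU (a j) m * b j) _ _ (begin
      b (j * (2 + m)) + lucasU (a j) m * b j      ≡⟨ cong₂ _+_ (cong b (sym j*[2+m])) (b-* j 2≤a m) ⟨
      b (j + (j + j * m)) + b (j * m)             ≡⟨ b-trace j (j * m) ⟩
      a j * b (j + j * m)                         ≡⟨ cong (a j *_) (trans (cong b (sym (*-suc j m))) (b-* j 2≤a (suc m))) ⟩
      a j * (lucasU (a j) (suc m) * b j)          ≡⟨ *-assoc (a j) _ (b j) ⟨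
      a j * lucasU (a j) (suc m) * b j            ≡⟨ cong (_* b j) (lucasU-rec 2≤a m) ⟨
      (lucasU (a j) (2 + m) + lucasU (a j) m) * b j
                                                  ≡⟨ *-distribʳ-+ (b j) (lucasU (a j) (2 + m)) _ ⟩
      lucasU (a j) (2 + m) * b j + lucasU (a j) m * b j ∎)
      where
      open ≡-Reasoning
      j*[2+m] : j * (2 + m) ≡ j + (j + j * m)
      j*[2+m] = trans (*-suc j (suc m)) (cong (j +_) (*-suc j m))

    r≡lucasU : ∀ j m → 2 ≤ a j → 0 < b j → r Δ t u j m ≡ lucasU (a j) m
    r≡lucasU j m 2≤a 0<b = trans (cong (_div b j) (b-* j 2≤a m)) (m*n-div-n≡m _ (b j) 0<b)

    a-1 : a 1 ≡ t
    a-1 = *-cancelˡ-≡ _ _ 2 (trans (IsProduct.fst (isProduct-suc 0)) (solve (t ∷ Δ ∷ u ∷ [])))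

    a-pos : 0 < t → ∀ j → 0 < a j
    a-pos 0<t zero    = z<s
    a-pos 0<t (suc j) = half-pos (IsProduct.fst (isProduct-suc j))
      (≤-trans (*-mono-≤ 0<t (a-pos 0<t j)) (m≤m+n _ _))

    b-pos : 0 < t → 0 < u → ∀ j → 0 < b (suc j)
    b-pos 0<t 0<u j = half-pos (IsProduct.snd (isProduct-suc j))
      (≤-trans (*-mono-≤ 0<u (a-pos 0<t j)) (m≤n+m _ _))

    b-pos⁻¹ : ∀ j → 0 < b j → 0 < j
    b-pos⁻¹ (suc j) _ = z<s

    module _ (3≤t : 3 ≤ t) where

      a-<-suc : ∀ j → a j < a (suc j)
      a-<-suc j = *-cancelˡ-< 2 (a j) (a (suc j)) (begin-strict
        2 * a j                       <⟨ *-monoˡ-< (a j) {{>-nonZero (a-pos (≤-trans z<s 3≤t) j)}} {2} {3} ≤-refl ⟩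
        3 * a j                       ≤⟨ *-monoˡ-≤ (a j) 3≤t ⟩
        t * a j                       ≤⟨ m≤m+n _ _ ⟩
        t * a j + Δ * (u * b j)       ≡⟨ IsProduct.fst (isProduct-suc j) ⟨
        2 * a (suc j)                 ∎)
        where open ≤-Reasoning

      a-injective : ∀ {i j} → a i ≡ a j → i ≡ j
      a-injective = <-suc⇒injective a-<-suc

      3≤a-suc : ∀ j → 3 ≤ a (suc j)
      3≤a-suc zero    = subst (3 ≤_) (sym a-1) 3≤t
      3≤a-suc (suc j) = ≤-trans (3≤a-suc j) (<⇒≤ (a-<-suc (suc j)))

  module _ (Δ t u : ℕ) (ε-norm : NormOne Δ t u) where

    -- (p + q √Δ)/2 = ε⁻¹ (x + y √Δ)/2 with ε⁻¹ = (t − u √Δ)/2, the hypotheses written without subtraction.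
    conjugate-isProduct : ∀ {x y p q} → 2 * p + Δ * (u * y) ≡ t * x → 2 * q + u * x ≡ t * y →
                          IsProduct Δ t u p q x y
    conjugate-isProduct {x} {y} {p} {q} 2p+Δuy≡tx 2q+ux≡ty = isProduct
      (*-cancelˡ-≡ _ _ 2 (+-cancelʳ-≡ (t * (Δ * (u * y)) + Δ * (u * (u * x))) _ _ (begin
        2 * (2 * x) + (t * (Δ * (u * y)) + Δ * (u * (u * x)))
          ≡⟨ solve (t ∷ x ∷ Δ ∷ u ∷ y ∷ []) ⟩
        (Δ * (u * u) + 4) * x + Δ * (u * (t * y))
          ≡⟨ cong (λ w → w * x + Δ * (u * (t * y))) ε-norm ⟨
        (t * t) * x + Δ * (u * (t * y))
          ≡⟨ solve (t ∷ x ∷ Δ ∷ u ∷ y ∷ []) ⟩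
        t * (t * x) + Δ * (u * (t * y))
          ≡⟨ cong₂ (λ v w → t * v + Δ * (u * w)) 2p+Δuy≡tx 2q+ux≡ty ⟨
        t * (2 * p + Δ * (u * y)) + Δ * (u * (2 * q + u * x))
          ≡⟨ solve (t ∷ p ∷ Δ ∷ u ∷ q ∷ y ∷ x ∷ []) ⟩
        2 * (t * p + Δ * (u * q)) + (t * (Δ * (u * y)) + Δ * (u * (u * x))) ∎)))
      (*-cancelˡ-≡ _ _ 2 (+-cancelʳ-≡ (t * (u * x) + u * (Δ * (u * y))) _ _ (begin
        2 * (2 * y) + (t * (u * x) + u * (Δ * (u * y)))
          ≡⟨ solve (t ∷ x ∷ Δ ∷ u ∷ y ∷ []) ⟩
        (Δ * (u * u) + 4) * y + u * (t * x)
          ≡⟨ cong (λ w → w * y + u * (t * x)) ε-norm ⟨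
        (t * t) * y + u * (t * x)
          ≡⟨ solve (t ∷ x ∷ u ∷ y ∷ []) ⟩
        t * (t * y) + u * (t * x)
          ≡⟨ cong₂ (λ v w → t * v + u * w) 2q+ux≡ty 2p+Δuy≡tx ⟨
        t * (2 * q + u * x) + u * (2 * p + Δ * (u * y))
          ≡⟨ solve (t ∷ p ∷ Δ ∷ u ∷ q ∷ y ∷ x ∷ []) ⟩
        2 * (t * q + u * p) + (t * (u * x) + u * (Δ * (u * y))) ∎)))
      where open ≡-Reasoning

    module _ (x y : ℕ) (xy-norm : NormOne Δ x y) where

      Δuy≤tx : Δ * (u * y) ≤ t * x
      Δuy≤tx = m*m≤n*n⇒m≤n _ _ (begin
        Δ * (u * y) * (Δ * (u * y))
          ≤⟨ m≤m+n _ _ ⟩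
        Δ * (u * y) * (Δ * (u * y)) + (4 * (Δ * (u * u)) + 4 * (Δ * (y * y)) + 16)
          ≡⟨ solve (Δ ∷ u ∷ y ∷ []) ⟩
        (Δ * (u * u) + 4) * (Δ * (y * y) + 4)
          ≡⟨ cong₂ _*_ ε-norm xy-norm ⟨
        (t * t) * (x * x)
          ≡⟨ solve (t ∷ x ∷ []) ⟩
        t * x * (t * x) ∎)
        where open ≤-Reasoning

      ux≤ty : u ≤ y → u * x ≤ t * y
      ux≤ty u≤y = m*m≤n*n⇒m≤n _ _ (begin
        u * x * (u * x)                        ≡⟨ solve (u ∷ x ∷ []) ⟩
        (u * u) * (x * x)                      ≡⟨ cong ((u * u) *_) xy-norm ⟩
        (u * u) * (Δ * (y * y) + 4)            ≡⟨ solve (u ∷ Δ ∷ y ∷ []) ⟩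
        Δ * (u * u) * (y * y) + 4 * (u * u)    ≤⟨ +-monoʳ-≤ (Δ * (u * u) * (y * y)) (*-monoʳ-≤ 4 (*-mono-≤ u≤y u≤y)) ⟩
        Δ * (u * u) * (y * y) + 4 * (y * y)    ≡⟨ solve (u ∷ Δ ∷ y ∷ []) ⟩
        (Δ * (u * u) + 4) * (y * y)            ≡⟨ cong (_* (y * y)) ε-norm ⟨
        (t * t) * (y * y)                      ≡⟨ solve (t ∷ y ∷ []) ⟩
        t * y * (t * y)                        ∎)
        where open ≤-Reasoning

      ty<ux+2y : 0 < u → t * y < u * x + 2 * y
      ty<ux+2y 0<u = m*m<n*n⇒m<n _ _ (begin-strict
        t * y * (t * y)                                      ≡⟨ solve (t ∷ y ∷ []) ⟩
        (t * t) * (y * y)                                    ≡⟨ cong (_* (y * y)) ε-norm ⟩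
        (Δ * (u * u) + 4) * (y * y)                          <⟨ m<m+n _ (≤-trans (*-mono-≤ 0<u 0<u) (m≤n*m (u * u) 4)) ⟩
        (Δ * (u * u) + 4) * (y * y) + 4 * (u * u)            ≡⟨ solve (Δ ∷ u ∷ y ∷ []) ⟩
        (u * u) * (Δ * (y * y) + 4) + 4 * (y * y)            ≡⟨ cong (λ w → (u * u) * w + 4 * (y * y)) xy-norm ⟨
        (u * u) * (x * x) + 4 * (y * y)                      ≤⟨ m≤m+n _ _ ⟩
        (u * u) * (x * x) + 4 * (y * y) + 4 * (u * (x * y))  ≡⟨ solve (u ∷ x ∷ y ∷ []) ⟩
        (u * x + 2 * y) * (u * x + 2 * y)                    ∎)
        where open ≤-Reasoning

      normOne-divide : 0 < u → u ≤ y → ∃₂ λ p q → IsProduct Δ t u p q x y × q < y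
      normOne-divide 0<u u≤y = p , q , conjugate-isProduct 2p+Δuy≡tx 2q+ux≡ty , q<y
        where
        even = normOne-product-even Δ t u x y ε-norm xy-norm
        p = (t * x ∸ Δ * (u * y)) / 2
        q = (t * y ∸ u * x) / 2
        2p+Δuy≡tx : 2 * p + Δ * (u * y) ≡ t * x
        2p+Δuy≡tx = trans (cong (_+ Δ * (u * y)) (m*[n/m]≡n (2∣m+n⇒2∣m∸n Δuy≤tx (proj₁ even)))) (m∸n+n≡m Δuy≤tx)
        2q+ux≡ty : 2 * q + u * x ≡ t * y
        2q+ux≡ty = trans (cong (_+ u * x) (m*[n/m]≡n (2∣m+n⇒2∣m∸n (ux≤ty u≤y) (proj₂ even)))) (m∸n+n≡m (ux≤ty u≤y))
        q<y : q < y
        q<y = *-cancelˡ-< 2 q y (+-cancelʳ-< (u * x) (2 * q) (2 * y) (begin-strict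
          2 * q + u * x    ≡⟨ 2q+ux≡ty ⟩
          t * y            <⟨ ty<ux+2y 0<u ⟩
          u * x + 2 * y    ≡⟨ +-comm (u * x) (2 * y) ⟩
          2 * y + u * x    ∎))
          where open ≤-Reasoning

  isProduct-unique : ∀ {Δ t u p q x y x′ y′} → IsProduct Δ t u p q x y → IsProduct Δ t u p q x′ y′ →
                     x ≡ x′ × y ≡ y′
  isProduct-unique (isProduct x≡ y≡) (isProduct x′≡ y′≡) =
    *-cancelˡ-≡ _ _ 2 (trans x≡ (sym x′≡)) , *-cancelˡ-≡ _ _ 2 (trans y≡ (sym y′≡))

  normOne⇒pos : ∀ Δ x y → NormOne Δ x y → 0 < x
  normOne⇒pos Δ x y eq = m*m<n*n⇒m<n 0 x (subst (0 <_) (sym eq) (<-≤-trans z<s (m≤n+m 4 (Δ * (y * y)))))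

  normOne⇒3≤ : ∀ Δ x y → 1 < Δ → 0 < y → NormOne Δ x y → 3 ≤ x
  normOne⇒3≤ Δ x y 1<Δ 0<y eq = m*m<n*n⇒m<n 2 x (begin-strict
    4                  <⟨ m<n+m 4 {2} z<s ⟩
    2 + 4              ≤⟨ +-monoˡ-≤ 4 (*-mono-≤ 1<Δ (*-mono-≤ 0<y 0<y)) ⟩
    Δ * (y * y) + 4    ≡⟨ eq ⟨
    x * x              ∎)
    where open ≤-Reasoning

  fundamentalUnit-exists : ∀ Δ x y → NormOne Δ x y → 0 < y → ∃₂ λ t u → IsFundUnit Δ t u
  fundamentalUnit-exists Δ x y xy-norm 0<y = fundamental (least P? y (0<y , x , xy-norm))
    where
    P : ℕ → Set
    P u = 0 < u × ∃ λ t → NormOne Δ t u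
    P? : ∀ u → Dec (P u)
    P? u = (0 <? u) ×-dec square? (Δ * (u * u) + 4)
    fundamental : (∃ λ u → P u × ∀ u′ → P u′ → u ≤ u′) → ∃₂ λ t u → IsFundUnit Δ t u
    fundamental (u , (0<u , t , tu-norm) , u-least) =
      t , u , (normOne⇒pos Δ t u tu-norm , 0<u , tu-norm) , λ t′ u′ (_ , 0<u′ , tu′-norm) →
        let u≤u′ = u-least u′ (0<u′ , t′ , tu′-norm) in
        m*m≤n*n⇒m≤n t t′ (subst₂ _≤_ (sym tu-norm) (sym tu′-norm)
                                   (+-monoˡ-≤ 4 (*-monoʳ-≤ Δ (*-mono-≤ u≤u′ u≤u′)))) ,
        u≤u′

  -- Dividing by ε lowers the √Δ-coordinate, until it vanishes at ε⁰ = 1.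
  module _ (Δ t u : ℕ) (fund : IsFundUnit Δ t u) where

    private
      ε-norm : NormOne Δ t u
      ε-norm = proj₂ (proj₂ (proj₁ fund))

    open Powers Δ t u ε-norm

    normOne⇒power : ∀ x y → NormOne Δ x y → ∃ λ j → a j ≡ x × b j ≡ y
    normOne⇒power x y = <-rec (λ y → ∀ x → NormOne Δ x y → ∃ λ j → a j ≡ x × b j ≡ y) step y x
      where
      step : ∀ y → (∀ {q} → q < y → ∀ p → NormOne Δ p q → ∃ λ j → a j ≡ p × b j ≡ q) →
             ∀ x → NormOne Δ x y → ∃ λ j → a j ≡ x × b j ≡ y
      step zero _ x eq = 0 , m*m≡n*n⇒m≡n 2 x (sym (trans eq (cong (_+ 4) (*-zeroʳ Δ)))) , refl
      step y@(suc _) rec x xy-norm = from-quotient (normOne-divide Δ t u ε-norm x y xy-norm 0<u u≤y)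
        where
        0<u : 0 < u
        0<u = proj₁ (proj₂ (proj₁ fund))
        u≤y : u ≤ y
        u≤y = proj₂ (proj₂ fund x y (normOne⇒pos Δ x y xy-norm , z<s , xy-norm))
        from-quotient : (∃₂ λ p q → IsProduct Δ t u p q x y × q < y) → ∃ λ j → a j ≡ x × b j ≡ y
        from-quotient (p , q , prod , q<y) =
          let j , aj≡p , bj≡q = rec q<y p (isProduct-normOne⁻¹ prod ε-norm xy-norm) in
          suc j , isProduct-unique (subst₂ (λ p q → IsProduct Δ t u p q (a (suc j)) (b (suc j))) aj≡p bj≡q (isProduct-suc j))
                                   prod

  fundamentalUnit-unique : ∀ {Δ t u t′ u′} → IsFundUnit Δ t u → IsFundUnit Δ t′ u′ → t ≡ t′ × u ≡ u′
  fundamentalUnit-unique (ε , ε-least) (ε′ , ε′-least) =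
    ≤-antisym t≤t′ t′≤t , ≤-antisym u≤u′ u′≤u
    where
    t≤t′×u≤u′ = ε-least _ _ ε′
    t≤t′ = proj₁ t≤t′×u≤u′
    u≤u′ = proj₂ t≤t′×u≤u′
    t′≤t×u′≤u = ε′-least _ _ ε
    t′≤t = proj₁ t′≤t×u′≤u
    u′≤u = proj₂ t′≤t×u′≤u

module Discriminants where

  open import Data.Nat
  open import Data.Nat.Properties
  open import Data.Nat.DivMod using (m/n*n≡m; m%n<n; m≡m%n+[m/n]*n; %-distribˡ-*; [m+n]%n≡m%n; m%n%n≡m%n)
  open import Data.Nat.Divisibility
  open import Data.Nat.GCD using (gcd; gcd[m,n]∣m; gcd[m,n]∣n; gcd[m,n]≢0)
  open import Data.Nat.Coprimality as Coprime using (Coprime; coprime-divisor; coprime-/gcd)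
  open import Data.Nat.Induction using (<-rec)
  open import Data.Nat.Tactic.RingSolver using (solve)
  open import Data.Sum using (_⊎_; inj₁; inj₂)
  import Data.Sum
  open import Data.Empty using (⊥-elim)
  open import Relation.Nullary using (¬_; yes; no; _×-dec_; contradiction)
  open Arithmetic
  open QuadraticUnits

  coprime-* : ∀ {m n o} → Coprime m n → Coprime m o → Coprime m (n * o)
  coprime-* {m} {n} m⊥n m⊥o (d∣m , d∣n*o) = m⊥o (d∣m , coprime-divisor d⊥n d∣n*o)
    where
    d⊥n : Coprime _ n
    d⊥n (e∣d , e∣n) = m⊥n (∣-trans e∣d d∣m , e∣n)

  squarefree-decomposition : ∀ M → 0 < M → ∃₂ λ q s → SquareFree q × M ≡ q * (s * s)
  squarefree-decomposition = <-rec _ step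
    where
    step : ∀ M → (∀ {c} → c < M → 0 < c → ∃₂ λ q s → SquareFree q × c ≡ q * (s * s)) →
           0 < M → ∃₂ λ q s → SquareFree q × M ≡ q * (s * s)
    step M rec 0<M with anyUpTo? (λ p → (1 <? p) ×-dec (p * p ∣? M)) (suc M)
    ... | yes (p , _ , 1<p , divides c M≡c*p²) with rec c<M 0<c
      where
      0<c : 0 < c
      0<c = n≢0⇒n>0 λ { refl → <⇒≢ 0<M (sym M≡c*p²) }
      c<M : c < M
      c<M = subst (c <_) (sym M≡c*p²) (m<m*n c (p * p) {{>-nonZero 0<c}} (*-mono-≤ 1<p (<⇒≤ 1<p)))
    ...   | q , s , q-sf , c≡q*s² = q , s * p , q-sf , (begin
      M                       ≡⟨ M≡c*p² ⟩
      c * (p * p)             ≡⟨ cong (_* (p * p)) c≡q*s² ⟩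
      q * (s * s) * (p * p)   ≡⟨ solve (q ∷ s ∷ p ∷ []) ⟩
      q * (s * p * (s * p))   ∎)
      where open ≡-Reasoning
    step M rec 0<M | no ∄p = M , 1 , M-sf , sym (*-identityʳ M)
      where
      M-sf : SquareFree M
      M-sf zero                0∣M = contradiction (sym (0∣⇒≡0 0∣M)) (<⇒≢ 0<M)
      M-sf (suc zero)          _   = refl
      M-sf p@(suc (suc _))     p²∣M = contradiction
        (p , s≤s (≤-trans (m≤m*m p) (∣⇒≤ {{>-nonZero 0<M}} p²∣M)) , s≤s (s≤s z≤n) , p²∣M) ∄p

  squarefree-∣-coprime : ∀ {q k s g} → SquareFree q → Coprime k s → 0 < g →
                         k * g * (k * g) ∣ q * (s * g * (s * g)) → k ≡ 1
  squarefree-∣-coprime {q} {k} {s} {g} q-sf k⊥s 0<g k²g²∣qs²g² = q-sf k k²∣q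
    where
    instance
      g*g≢0 : NonZero (g * g)
      g*g≢0 = >-nonZero (*-mono-≤ 0<g 0<g)
    k²⊥s : Coprime (k * k) s
    k²⊥s = Coprime.sym (coprime-* (Coprime.sym k⊥s) (Coprime.sym k⊥s))
    k²∣s*[s*q] : k * k ∣ s * (s * q)
    k²∣s*[s*q] = *-cancelʳ-∣ (g * g) (subst₂ _∣_ k²g²≡ qs²g²≡ k²g²∣qs²g²)
      where
      k²g²≡ : k * g * (k * g) ≡ k * k * (g * g)
      k²g²≡ = solve (k ∷ g ∷ [])
      qs²g²≡ : q * (s * g * (s * g)) ≡ s * (s * q) * (g * g)
      qs²g²≡ = solve (q ∷ s ∷ g ∷ [])
    k²∣q : k * k ∣ q
    k²∣q = coprime-divisor k²⊥s (coprime-divisor k²⊥s k²∣s*[s*q])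

  -- Dividing k and s by their gcd reduces to the coprime case.
  squarefree-∣ : ∀ {q k s} → SquareFree q → 0 < k → k * k ∣ q * (s * s) → k ∣ s
  squarefree-∣ {q} {k} {s} q-sf 0<k k²∣qs² = subst (_∣ s) g≡k (gcd[m,n]∣n k s)
    where
    g = gcd k s
    0<g : 0 < g
    0<g = n≢0⇒n>0 (gcd[m,n]≢0 k s (inj₁ (≢-sym (<⇒≢ 0<k))))
    instance
      g≢0 : NonZero g
      g≢0 = >-nonZero 0<g
    k′g≡k : k / g * g ≡ k
    k′g≡k = m/n*n≡m (gcd[m,n]∣m k s)
    s′g≡s : s / g * g ≡ s
    s′g≡s = m/n*n≡m (gcd[m,n]∣n k s)
    k′≡1 : k / g ≡ 1
    k′≡1 = squarefree-∣-coprime q-sf (coprime-/gcd k s) 0<g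
      (subst₂ (λ k s → k * k ∣ q * (s * s)) (sym k′g≡k) (sym s′g≡s) k²∣qs²)
    g≡k : g ≡ k
    g≡k = trans (sym (*-identityˡ g)) (trans (cong (_* g) (sym k′≡1)) k′g≡k)

  squarefree-unique : ∀ {q q′ F F′} → SquareFree q → SquareFree q′ → 0 < F → 0 < F′ →
                      q * (F * F) ≡ q′ * (F′ * F′) → q ≡ q′
  squarefree-unique {q} {q′} {F} {F′} q-sf q′-sf 0<F 0<F′ eq =
    *-cancelʳ-≡ q q′ (F * F) {{>-nonZero (*-mono-≤ 0<F 0<F)}} (trans eq (cong (λ w → q′ * (w * w)) (sym F≡F′)))
    where
    F≡F′ : F ≡ F′
    F≡F′ = ∣-antisym (squarefree-∣ q′-sf 0<F (subst (F * F ∣_) eq (n∣m*n q)))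
                     (squarefree-∣ q-sf 0<F′ (subst (F′ * F′ ∣_) (sym eq) (n∣m*n q′)))

  Kernel : ℕ → ℕ → Set
  Kernel Δ q = SquareFree q × (Δ ≡ q × q % 4 ≡ 1 ⊎ Δ ≡ 4 * q × (q % 4 ≡ 2 ⊎ q % 4 ≡ 3))

  disc-kernel : ∀ Δ f → RealQuadDisc Δ → 0 < f →
                ∃₂ λ q F → Kernel Δ q × 0 < F × Δ * (f * f) ≡ q * (F * F)
  disc-kernel Δ f (_ , inj₁ (Δ%4≡1 , Δ-sf)) 0<f = Δ , f , (Δ-sf , inj₁ (refl , Δ%4≡1)) , 0<f , refl
  disc-kernel Δ f (_ , inj₂ (q , refl , q%4 , q-sf)) 0<f =
    q , 2 * f , (q-sf , inj₂ (refl , q%4)) , *-mono-≤ {1} {2} (s≤s z≤n) 0<f , solve (q ∷ f ∷ [])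

  mod4-clash : ∀ {m n} → m ≡ n → m % 4 ≡ 1 → ¬ (n % 4 ≡ 2 ⊎ n % 4 ≡ 3)
  mod4-clash refl m%4≡1 (inj₁ m%4≡2) = contradiction (trans (sym m%4≡1) m%4≡2) λ ()
  mod4-clash refl m%4≡1 (inj₂ m%4≡3) = contradiction (trans (sym m%4≡1) m%4≡3) λ ()

  disc-unique : ∀ Δ Δ′ f f′ → RealQuadDisc Δ → RealQuadDisc Δ′ → 0 < f → 0 < f′ →
                Δ * (f * f) ≡ Δ′ * (f′ * f′) → Δ ≡ Δ′
  disc-unique Δ Δ′ f f′ disc disc′ 0<f 0<f′ eq
    with disc-kernel Δ f disc 0<f | disc-kernel Δ′ f′ disc′ 0<f′
  ... | q , F , (q-sf , shape) , 0<F , Δf²≡ | q′ , F′ , (q′-sf , shape′) , 0<F′ , Δ′f′²≡ =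
    same-shape shape shape′
    where
    q≡q′ : q ≡ q′
    q≡q′ = squarefree-unique q-sf q′-sf 0<F 0<F′ (trans (sym Δf²≡) (trans eq Δ′f′²≡))
    same-shape : (Δ ≡ q × q % 4 ≡ 1 ⊎ Δ ≡ 4 * q × (q % 4 ≡ 2 ⊎ q % 4 ≡ 3)) →
                 (Δ′ ≡ q′ × q′ % 4 ≡ 1 ⊎ Δ′ ≡ 4 * q′ × (q′ % 4 ≡ 2 ⊎ q′ % 4 ≡ 3)) → Δ ≡ Δ′
    same-shape (inj₁ (Δ≡q , _))    (inj₁ (Δ′≡q′ , _))   = trans Δ≡q (trans q≡q′ (sym Δ′≡q′))
    same-shape (inj₂ (Δ≡4q , _))   (inj₂ (Δ′≡4q′ , _))  = trans Δ≡4q (trans (cong (4 *_) q≡q′) (sym Δ′≡4q′))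
    same-shape (inj₁ (_ , q%4≡1))  (inj₂ (_ , q′%4))    = ⊥-elim (mod4-clash q≡q′ q%4≡1 q′%4)
    same-shape (inj₂ (_ , q%4))    (inj₁ (_ , q′%4≡1))  = ⊥-elim (mod4-clash (sym q≡q′) q′%4≡1 q%4)

  square%4 : ∀ n → (2 ∣ n × (n * n) % 4 ≡ 0) ⊎ (n * n) % 4 ≡ 1
  square%4 n with n % 4 | m%n<n n 4 | m≡m%n+[m/n]*n n 4 | %-distribˡ-* n n 4
  ... | 0 | _ | n≡0+k*4 | n²%4 = inj₁ (subst (2 ∣_) (sym n≡0+k*4) 2∣k*4 , n²%4)
    where 2∣k*4 = ∣-trans (divides 2 refl) (n∣m*n (n / 4))
  ... | 1 | _ | _       | n²%4 = inj₂ n²%4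
  ... | 2 | _ | n≡2+k*4 | n²%4 = inj₁ (subst (2 ∣_) (sym n≡2+k*4) (∣m∣n⇒∣m+n ∣-refl 2∣k*4) , n²%4)
    where 2∣k*4 = ∣-trans (divides 2 refl) (n∣m*n (n / 4))
  ... | 3 | _ | _       | n²%4 = inj₂ n²%4
  ... | suc (suc (suc (suc _))) | s≤s (s≤s (s≤s (s≤s ()))) | _ | _

  %4-cases : ∀ n → n % 4 ≡ 0 ⊎ n % 4 ≡ 1 ⊎ n % 4 ≡ 2 ⊎ n % 4 ≡ 3
  %4-cases n with n % 4 | m%n<n n 4
  ... | 0 | _ = inj₁ refl
  ... | 1 | _ = inj₂ (inj₁ refl)
  ... | 2 | _ = inj₂ (inj₂ (inj₁ refl))
  ... | 3 | _ = inj₂ (inj₂ (inj₂ refl))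
  ... | suc (suc (suc (suc _))) | s≤s (s≤s (s≤s (s≤s ())))

  square-gap : ∀ a s → 3 ≤ a → a * a ≢ s * s + 4
  square-gap a@(suc a′) s (s≤s 2≤a′) eq = <-irrefl (sym eq) (begin-strict
    s * s + 4              ≤⟨ +-monoˡ-≤ 4 (*-mono-≤ s≤a′ s≤a′) ⟩
    a′ * a′ + 4            <⟨ +-monoʳ-< (a′ * a′) (s≤s (*-monoʳ-≤ 2 2≤a′)) ⟩
    a′ * a′ + suc (2 * a′) ≡⟨ solve (a′ ∷ []) ⟩
    a * a                  ∎)
    where
    open ≤-Reasoning
    s≤a′ : s ≤ a′
    s≤a′ = s≤s⁻¹ (m*m<n*n⇒m<n s a (subst (s * s <_) (sym eq) (m<m+n (s * s) z<s)))

  -- For odd s we would get q ≡ a² ≡ 0 or 1 (mod 4).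
  normOne⇒even : ∀ q a s → NormOne q a s → (q % 4 ≡ 2 ⊎ q % 4 ≡ 3) → 2 ∣ s
  normOne⇒even q a s a²≡ q%4 with square%4 s
  ... | inj₁ (2∣s , _) = 2∣s
  ... | inj₂ s²%4≡1   = ⊥-elim (residue-clash (Data.Sum.map₁ proj₂ (square%4 a))
                                               (subst (λ r → r ≡ 2 ⊎ r ≡ 3) q%4≡a²%4 q%4))
    where
    q%4≡a²%4 : q % 4 ≡ (a * a) % 4
    q%4≡a²%4 = sym (begin
      (a * a) % 4                    ≡⟨ cong (_% 4) a²≡ ⟩
      (q * (s * s) + 4) % 4          ≡⟨ [m+n]%n≡m%n (q * (s * s)) 4 ⟩
      (q * (s * s)) % 4              ≡⟨ %-distribˡ-* q (s * s) 4 ⟩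
      ((q % 4) * ((s * s) % 4)) % 4  ≡⟨ cong (λ w → ((q % 4) * w) % 4) s²%4≡1 ⟩
      ((q % 4) * 1) % 4              ≡⟨ cong (_% 4) (*-identityʳ (q % 4)) ⟩
      (q % 4) % 4                    ≡⟨ m%n%n≡m%n q 4 ⟩
      q % 4                          ∎)
      where open ≡-Reasoning
    residue-clash : ∀ {r} → (r ≡ 0 ⊎ r ≡ 1) → ¬ (r ≡ 2 ⊎ r ≡ 3)
    residue-clash (inj₁ refl) (inj₁ ())
    residue-clash (inj₁ refl) (inj₂ ())
    residue-clash (inj₂ refl) (inj₁ ())
    residue-clash (inj₂ refl) (inj₂ ())

  normOne-halve : ∀ q a k → NormOne q a (k * 2) → NormOne (4 * q) a k
  normOne-halve q a k a²≡ = trans a²≡ (cong (_+ 4) (solve (q ∷ k ∷ [])))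

  -- a² − 4 = q s² with q square-free; then Δ = q if q ≡ 1 (mod 4), and Δ = 4q otherwise.
  disc-exists : ∀ a → 3 ≤ a → ∃₂ λ Δ f → RealQuadDisc Δ × 0 < f × NormOne Δ a f
  disc-exists a 3≤a = from-decomposition (squarefree-decomposition (a * a ∸ 4) (m<n⇒0<n∸m 4<a*a))
    where
    4<a*a : 4 < a * a
    4<a*a = ≤-trans (s≤s (s≤s (s≤s (s≤s (s≤s z≤n))))) (*-mono-≤ 3≤a 3≤a)
    from-decomposition : (∃₂ λ q s → SquareFree q × a * a ∸ 4 ≡ q * (s * s)) →
                         ∃₂ λ Δ f → RealQuadDisc Δ × 0 < f × NormOne Δ a f
    from-decomposition (q , s , q-sf , M≡qs²) = by-residue (%4-cases q)
      where
      a²≡ : NormOne q a s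
      a²≡ = trans (sym (m∸n+n≡m (<⇒≤ 4<a*a))) (cong (_+ 4) M≡qs²)
      0<qs² : 0 < q * (s * s)
      0<qs² = subst (0 <_) M≡qs² (m<n⇒0<n∸m 4<a*a)
      0<q : 0 < q
      0<q = n≢0⇒n>0 λ { refl → <-irrefl refl 0<qs² }
      0<s : 0 < s
      0<s = n≢0⇒n>0 λ { refl → <-irrefl (sym (*-zeroʳ q)) 0<qs² }
      by-residue : q % 4 ≡ 0 ⊎ q % 4 ≡ 1 ⊎ q % 4 ≡ 2 ⊎ q % 4 ≡ 3 →
                   ∃₂ λ Δ f → RealQuadDisc Δ × 0 < f × NormOne Δ a f
      by-residue (inj₁ q%4≡0)        = contradiction (q-sf 2 (m%n≡0⇒n∣m q 4 q%4≡0)) λ ()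
      by-residue (inj₂ (inj₁ q%4≡1)) = q , s , (1<q , inj₁ (q%4≡1 , q-sf)) , 0<s , a²≡
        where
        1<q : 1 < q
        1<q = ≤∧≢⇒< 0<q λ { refl → square-gap a s 3≤a (trans a²≡ (cong (_+ 4) (*-identityˡ (s * s)))) }
      by-residue (inj₂ (inj₂ q%4))   = from-even (normOne⇒even q a s a²≡ q%4)
        where
        from-even : 2 ∣ s → ∃₂ λ Δ f → RealQuadDisc Δ × 0 < f × NormOne Δ a f
        from-even (divides k s≡k*2) =
          4 * q , k , (≤-trans (s≤s (s≤s z≤n)) (*-monoʳ-≤ 4 0<q) , inj₂ (q , refl , q%4 , q-sf)) ,
          n≢0⇒n>0 (λ { refl → <-irrefl (sym s≡k*2) 0<s }) , normOne-halve q a k (subst (NormOne q a) s≡k*2 a²≡)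

open import Data.Integer using (ℤ; +_; +[1+_]; -[1+_]; _+_; _-_; _*_; _<_; +<+)
open import Data.Integer.Properties using (pos-+; pos-*; +-injective; m-n≡m⊖n; ⊖-≥; drop‿+<+)
open import Data.Integer.Tactic.RingSolver using (solve-∀)
open import Function.Bundles using (_⇔_; mk⇔; Equivalence)
open Lucas
open QuadraticUnits
open Discriminants

pos-∸ : ∀ {m n} → n ℕ.≤ m → + m - + n ≡ + (m ℕ.∸ n)
pos-∸ {m} {n} n≤m = trans (m-n≡m⊖n m n) (⊖-≥ n≤m)

grid-equation⇔ : ∀ N x y →
  (+ N * + x * (+ (y ℕ.+ x) - + x) ≡ + (y ℕ.+ x) * + (y ℕ.+ x) - + 1) ⇔
  (N ℕ.* x ℕ.* y ℕ.+ 1 ≡ (y ℕ.+ x) ℕ.* (y ℕ.+ x))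
grid-equation⇔ N x y = mk⇔
  (λ eq → +-injective (begin
    + (K ℕ.+ 1)            ≡⟨ pos-+ K 1 ⟩
    + K + + 1              ≡⟨ cong (_+ + 1) (trans (sym lhs≡) eq) ⟩
    + D * + D - + 1 + + 1  ≡⟨ minus-plus (+ D * + D) ⟩
    + D * + D              ≡⟨ pos-* D D ⟨
    + (D ℕ.* D)            ∎))
  (λ eq → begin
    + N * + x * (+ D - + x)  ≡⟨ lhs≡ ⟩
    + K                      ≡⟨ plus-minus (+ K) ⟨
    + K + + 1 - + 1          ≡⟨ cong (_- + 1) (pos-+ K 1) ⟨
    + (K ℕ.+ 1) - + 1        ≡⟨ cong (λ w → + w - + 1) eq ⟩
    + (D ℕ.* D) - + 1        ≡⟨ cong (_- + 1) (pos-* D D) ⟩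
    + D * + D - + 1          ∎)
  where
  open ≡-Reasoning
  D = y ℕ.+ x
  K = N ℕ.* x ℕ.* y
  lhs≡ : + N * + x * (+ D - + x) ≡ + K
  lhs≡ = begin
    + N * + x * (+ D - + x)   ≡⟨ cong (+ N * + x *_) (trans (pos-∸ (ℕ.m≤n+m x y)) (cong +_ (ℕ.m+n∸n≡m y x))) ⟩
    + N * + x * + y           ≡⟨ cong (_* + y) (pos-* N x) ⟨
    + (N ℕ.* x) * + y         ≡⟨ pos-* (N ℕ.* x) y ⟨
    + K                       ∎
  minus-plus : ∀ z → z - + 1 + + 1 ≡ z
  minus-plus = solve-∀
  plus-minus : ∀ z → z + + 1 - + 1 ≡ z
  plus-minus = solve-∀

record LucasRow (Δ t u j : ℕ) : Set where
  field
    trace      : ℕ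
    3≤trace    : 3 ℕ.≤ trace
    a≡trace    : proj₁ (εpow Δ t u j) ≡ trace
    trace-norm : NormOne Δ trace (f Δ t u j)
    0<f        : 0 ℕ.< f Δ t u j
    r≡lucasU   : ∀ m → r Δ t u j m ≡ lucasU trace m

  dg≡ : ∀ m → dg Δ t u j m ≡ lucasU trace (suc m) ℕ.+ lucasU trace m
  dg≡ m = cong₂ ℕ._+_ (r≡lucasU (suc m)) (r≡lucasU m)

  d₁≡ : d₁ Δ t u j ≡ trace ℕ.+ 1
  d₁≡ = trans (dg≡ 1) (cong (ℕ._+ 1) (lucasU-2 trace))

lucasRow : ∀ Δ t u j → RealQuadDisc Δ → IsFundUnit Δ t u → 0 ℕ.< j → LucasRow Δ t u j
lucasRow Δ t u (suc j) (1<Δ , _) ((0<t , 0<u , ε-norm) , _) _ = record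
  { trace      = a (suc j)
  ; 3≤trace    = 3≤a-suc 3≤t j
  ; a≡trace    = refl
  ; trace-norm = normOne-pow (suc j)
  ; 0<f        = b-pos 0<t 0<u j
  ; r≡lucasU   = λ m → r≡lucasU (suc j) m (ℕ.≤-trans (s≤s (s≤s z≤n)) (3≤a-suc 3≤t j)) (b-pos 0<t 0<u j)
  }
  where
  open Powers Δ t u ε-norm
  3≤t : 3 ℕ.≤ t
  3≤t = normOne⇒3≤ Δ t u 1<Δ 0<u ε-norm

markov⇒grid-relations : ∀ {R D E A x y} → R ≡ x → D ≡ y ℕ.+ x → E ≡ A ℕ.+ 1 →
                        0 ℕ.< x → x ℕ.+ 1 ℕ.< y → Markov A x y →
                        (+ 0 < + R) × (+ 2 * + R < + D - + 1) × ((+ E + + 1) * + R * (+ D - + R) ≡ + D * + D - + 1)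
markov⇒grid-relations {A = A} {x} {y} refl refl refl 0<x x+1<y markov = +<+ 0<x , gap , grid
  where
  2x<y+x∸1 : 2 ℕ.* x ℕ.< y ℕ.+ x ℕ.∸ 1
  2x<y+x∸1 = ℕ.m+n≤o⇒m≤o∸n (suc (2 ℕ.* x)) (ℕ.≤-trans (ℕ.≤-reflexive 2x+2≡x+2+x) (ℕ.+-monoˡ-≤ x x+1<y))
    where
    2x+2≡x+2+x : suc (2 ℕ.* x) ℕ.+ 1 ≡ suc (x ℕ.+ 1) ℕ.+ x
    2x+2≡x+2+x = ℕ-Solver.solve (x ∷ [])
  gap : + 2 * + x < + (y ℕ.+ x) - + 1
  gap = subst₂ _<_ (pos-* 2 x) (sym (pos-∸ (ℕ.≤-trans 0<x (ℕ.m≤n+m x y)))) (+<+ 2x<y+x∸1)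
  grid : (+ (A ℕ.+ 1) + + 1) * + x * (+ (y ℕ.+ x) - + x) ≡ + (y ℕ.+ x) * + (y ℕ.+ x) - + 1
  grid = subst (λ N → N * + x * (+ (y ℕ.+ x) - + x) ≡ + (y ℕ.+ x) * + (y ℕ.+ x) - + 1)
    (trans (cong +_ (sym (ℕ.+-assoc A 1 1))) (pos-+ (A ℕ.+ 1) 1))
    (Equivalence.from (grid-equation⇔ (A ℕ.+ 2) x y) (Equivalence.to (markov⇔square A x y) markov))

grid-relations⇒markov : ∀ rr d n → + 0 < rr → + 2 * rr < d - + 1 → + 4 < n → n * rr * (d - rr) ≡ d * d - + 1 →
  ∃ λ x → ∃ λ y → ∃ λ A → rr ≡ + x × d ≡ + (y ℕ.+ x) × n ≡ + (A ℕ.+ 2) ×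
                          0 ℕ.< x × x ℕ.+ 1 ℕ.< y × 3 ℕ.≤ A × Markov A x y
grid-relations⇒markov (+ zero)   _             _          (+<+ ()) _ _ _
grid-relations⇒markov -[1+ _ ]   _             _          ()       _ _ _
grid-relations⇒markov +[1+ x′ ]  -[1+ _ ]      _          _        () _ _
grid-relations⇒markov +[1+ x′ ]  (+ zero)      _          _        () _ _
grid-relations⇒markov +[1+ x′ ]  (+ suc D′)    -[1+ _ ]   _        _ () _
grid-relations⇒markov +[1+ x′ ]  (+ suc D′)    (+ N)      _        gap (+<+ 4<N) eq =
  x , y , A , refl , cong +_ (sym y+x≡D) , cong +_ N≡A+2 , z<s , x+1<y , 3≤A ,
  Equivalence.from (markov⇔square A x y) (Equivalence.to (grid-equation⇔ (A ℕ.+ 2) x y)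
    (subst₂ (λ N D → + N * + x * (+ D - + x) ≡ + D * + D - + 1) N≡A+2 (sym y+x≡D) eq))
  where
  x = suc x′
  D = suc D′
  2x<D′ : 2 ℕ.* x ℕ.< D′
  2x<D′ = drop‿+<+ (subst (_< + D′) (sym (pos-* 2 x)) gap)
  x+1+x<D : x ℕ.+ 1 ℕ.+ x ℕ.< D
  x+1+x<D = s≤s (ℕ.≤-trans (ℕ.≤-reflexive (m+1+m≡1+2m x)) 2x<D′)
    where
    m+1+m≡1+2m : ∀ m → m ℕ.+ 1 ℕ.+ m ≡ suc (2 ℕ.* m)
    m+1+m≡1+2m = ℕ-Solver.solve-∀
  y = D ℕ.∸ x
  y+x≡D : y ℕ.+ x ≡ D
  y+x≡D = ℕ.m∸n+n≡m (ℕ.≤-trans (ℕ.m≤n+m x (x ℕ.+ 1)) (ℕ.<⇒≤ x+1+x<D))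
  x+1<y : x ℕ.+ 1 ℕ.< y
  x+1<y = ℕ.+-cancelʳ-≤ x _ _ (subst (suc (x ℕ.+ 1) ℕ.+ x ℕ.≤_) (sym y+x≡D) x+1+x<D)
  A = N ℕ.∸ 2
  N≡A+2 : N ≡ A ℕ.+ 2
  N≡A+2 = sym (ℕ.m∸n+n≡m (ℕ.≤-trans (s≤s (s≤s z≤n)) (ℕ.<⇒≤ 4<N)))
  3≤A : 3 ℕ.≤ A
  3≤A = ℕ.+-cancelʳ-≤ 2 3 A (subst (5 ℕ.≤_) N≡A+2 4<N)

grid-injective : ∀ {Δ t u j m Δ′ t′ u′ j′ m′} →
  RealQuadDisc Δ → IsFundUnit Δ t u → 0 ℕ.< j → RealQuadDisc Δ′ → IsFundUnit Δ′ t′ u′ → 0 ℕ.< j′ →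
  r Δ t u j m ≡ r Δ′ t′ u′ j′ m′ → d₁ Δ t u j ≡ d₁ Δ′ t′ u′ j′ → Δ ≡ Δ′ × j ≡ j′ × m ≡ m′
grid-injective {Δ} {t} {u} {j} {m} {Δ′} {t′} {u′} {j′} {m′}
               disc@(1<Δ , _) fund@((_ , 0<u , ε-norm) , _) 0<j disc′ fund′ 0<j′ r≡r′ d₁≡d₁′ =
  Δ≡Δ′ , j≡j′ , m≡m′
  where
  module R  = LucasRow (lucasRow Δ t u j disc fund 0<j)
  module R′ = LucasRow (lucasRow Δ′ t′ u′ j′ disc′ fund′ 0<j′)
  trace≡ : R.trace ≡ R′.trace
  trace≡ = ℕ.+-cancelʳ-≡ 1 _ _ (trans (sym R.d₁≡) (trans d₁≡d₁′ R′.d₁≡))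
  Δ≡Δ′ : Δ ≡ Δ′
  Δ≡Δ′ = disc-unique Δ Δ′ _ _ disc disc′ R.0<f R′.0<f
    (ℕ.+-cancelʳ-≡ 4 _ _ (trans (sym R.trace-norm) (trans (cong (λ a → a ℕ.* a) trace≡) R′.trace-norm)))
  same-powers : ∀ {Δ″ t″ u″} → Δ ≡ Δ″ → IsFundUnit Δ″ t″ u″ →
                ∀ i → proj₁ (εpow Δ t u i) ≡ proj₁ (εpow Δ″ t″ u″ i)
  same-powers refl fund″ i with fundamentalUnit-unique {Δ} fund fund″
  ... | refl , refl = refl
  j≡j′ : j ≡ j′
  j≡j′ = a-injective (normOne⇒3≤ Δ t u 1<Δ 0<u ε-norm)
    (trans R.a≡trace (trans trace≡ (trans (sym R′.a≡trace) (sym (same-powers Δ≡Δ′ fund′ j′)))))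
    where open Powers Δ t u ε-norm
  m≡m′ : m ≡ m′
  m≡m′ = lucasU-injective (ℕ.≤-trans (ℕ.n≤1+n 2) R.3≤trace)
    (trans (sym (R.r≡lucasU m)) (trans r≡r′ (trans (R′.r≡lucasU m′) (cong (λ a → lucasU a m′) (sym trace≡)))))

partA : ∀ (Δ t u : ℕ) → RealQuadDisc Δ → IsFundUnit Δ t u → ∀ (j m : ℕ) → + 0 < + j → + 0 < + m →
        (+ 0 < + r Δ t u j m) × (+ 2 * + r Δ t u j m < + dg Δ t u j m - + 1)
        × ((+ d₁ Δ t u j + + 1) * + r Δ t u j m * (+ dg Δ t u j m - + r Δ t u j m) ≡ + dg Δ t u j m * + dg Δ t u j m - + 1)
partA Δ t u disc fund j zero    _          (+<+ ())
partA Δ t u disc fund j (suc m) (+<+ 0<j) _ =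
  markov⇒grid-relations (r≡lucasU (suc m)) (dg≡ (suc m)) d₁≡
    (lucasU-pos 2≤trace m) (lucasU-gap 2≤trace 3≤trace m) (markov-lucasU 2≤trace (suc m))
  where
  open LucasRow (lucasRow Δ t u j disc fund 0<j)
  2≤trace : 2 ℕ.≤ trace
  2≤trace = ℕ.≤-trans (ℕ.n≤1+n 2) 3≤trace

Realises : ℤ → ℤ → ℤ → ℕ → ℕ → ℕ → ℕ → ℕ → Set
Realises rr d n Δ t u j m = RealQuadDisc Δ × IsFundUnit Δ t u × + 0 < + j × + 0 < + m
                            × rr ≡ + r Δ t u j m × d ≡ + dg Δ t u j m × n ≡ + d₁ Δ t u j + + 1

row-realises : ∀ Δ t u j m {x y A} → RealQuadDisc Δ → IsFundUnit Δ t u → 0 ℕ.< j →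
               proj₁ (εpow Δ t u j) ≡ A → lucasU A (suc m) ≡ x → lucasU A (2 ℕ.+ m) ≡ y →
               Realises (+ x) (+ (y ℕ.+ x)) (+ (A ℕ.+ 2)) Δ t u j (suc m)
row-realises Δ t u j m {x} {y} {A} disc fund 0<j aj≡A U₁≡x U₂≡y =
  disc , fund , +<+ 0<j , +<+ z<s ,
  cong +_ (sym (trans (r≡lucasU (suc m)) U₁≡x′)) ,
  cong +_ (sym (trans (dg≡ (suc m)) (cong₂ ℕ._+_ U₂≡y′ U₁≡x′))) ,
  trans (cong +_ A+2≡d₁+1) (pos-+ (d₁ Δ t u j) 1)
  where
  open LucasRow (lucasRow Δ t u j disc fund 0<j)
  trace≡A : trace ≡ A
  trace≡A = trans (sym a≡trace) aj≡A
  U₁≡x′ : lucasU trace (suc m) ≡ x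
  U₁≡x′ = trans (cong (λ a → lucasU a (suc m)) trace≡A) U₁≡x
  U₂≡y′ : lucasU trace (2 ℕ.+ m) ≡ y
  U₂≡y′ = trans (cong (λ a → lucasU a (2 ℕ.+ m)) trace≡A) U₂≡y
  A+2≡d₁+1 : A ℕ.+ 2 ≡ d₁ Δ t u j ℕ.+ 1
  A+2≡d₁+1 = sym (trans (cong (ℕ._+ 1) (trans d₁≡ (cong (ℕ._+ 1) trace≡A))) (ℕ.+-assoc A 1 1))

markov⇒realisation : ∀ {x y A} → 0 ℕ.< x → x ℕ.+ 1 ℕ.< y → 3 ℕ.≤ A → Markov A x y →
              Σ ℕ λ Δ → Σ ℕ λ t → Σ ℕ λ u → Σ ℕ λ j → Σ ℕ λ m →
                Realises (+ x) (+ (y ℕ.+ x)) (+ (A ℕ.+ 2)) Δ t u j m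
markov⇒realisation {x} {y} {A} 0<x x+1<y 3≤A markov =
  let m , U₁≡x , U₂≡y = markov⇒lucasU (ℕ.≤-trans (ℕ.n≤1+n 2) 3≤A) x y 0<x x+1<y markov
      Δ , f₀ , disc , 0<f₀ , A-norm = disc-exists A 3≤A
      t , u , fund@((_ , _ , ε-norm) , _) = fundamentalUnit-exists Δ A f₀ A-norm 0<f₀
      j , aj≡A , bj≡f₀ = normOne⇒power Δ t u fund A f₀ A-norm
      0<j = Powers.b-pos⁻¹ Δ t u ε-norm j (subst (0 ℕ.<_) (sym bj≡f₀) 0<f₀)
  in Δ , t , u , j , suc m , row-realises Δ t u j m disc fund 0<j aj≡A U₁≡x U₂≡y

+m+1-injective : ∀ {m n} → + m + + 1 ≡ + n + + 1 → m ≡ n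
+m+1-injective {m} {n} eq = ℕ.+-cancelʳ-≡ 1 m n (+-injective (trans (pos-+ m 1) (trans eq (sym (pos-+ n 1)))))

UniqueRealisation : ℤ → ℤ → ℤ → Set
UniqueRealisation rr d n =
  Σ ℕ λ Δ → Σ ℕ λ t → Σ ℕ λ u → Σ ℕ λ j → Σ ℕ λ m →
    Realises rr d n Δ t u j m
    × (∀ (Δ′ t′ u′ j′ m′ : ℕ) → RealQuadDisc Δ′ → IsFundUnit Δ′ t′ u′ → + 0 < + j′ → + 0 < + m′ →
         rr ≡ + r Δ′ t′ u′ j′ m′ → d ≡ + dg Δ′ t′ u′ j′ m′ → n ≡ + d₁ Δ′ t′ u′ j′ + + 1 →
         Δ′ ≡ Δ × j′ ≡ j × m′ ≡ m)

markov⇒uniqueRealisation : ∀ {x y A} → 0 ℕ.< x → x ℕ.+ 1 ℕ.< y → 3 ℕ.≤ A → Markov A x y →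
          UniqueRealisation (+ x) (+ (y ℕ.+ x)) (+ (A ℕ.+ 2))
markov⇒uniqueRealisation 0<x x+1<y 3≤A markov = unique (markov⇒realisation 0<x x+1<y 3≤A markov)
  where
  unique : ∀ {rr d n} → (Σ ℕ λ Δ → Σ ℕ λ t → Σ ℕ λ u → Σ ℕ λ j → Σ ℕ λ m → Realises rr d n Δ t u j m) →
           UniqueRealisation rr d n
  unique (Δ , t , u , j , m , realises@(disc , fund , +<+ 0<j , _ , rr≡r , _ , n≡d₁+1)) =
    Δ , t , u , j , m , realises , λ Δ′ t′ u′ j′ m′ disc′ fund′ 0<j′ _ rr≡r′ _ n≡d₁′+1 →
      grid-injective disc′ fund′ (drop‿+<+ 0<j′) disc fund 0<j
        (+-injective (trans (sym rr≡r′) rr≡r)) (+m+1-injective (trans (sym n≡d₁′+1) n≡d₁+1))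

partB : ∀ (rr d n : ℤ) → + 0 < rr → + 2 * rr < d - + 1 → + 4 < n → n * rr * (d - rr) ≡ d * d - + 1 →
        UniqueRealisation rr d n
partB rr d n 0<rr gap 4<n eq = from-ℕ rr d n (grid-relations⇒markov rr d n 0<rr gap 4<n eq)
  where
  from-ℕ : ∀ rr d n → (∃ λ x → ∃ λ y → ∃ λ A → rr ≡ + x × d ≡ + (y ℕ.+ x) × n ≡ + (A ℕ.+ 2) ×
                                               0 ℕ.< x × x ℕ.+ 1 ℕ.< y × 3 ℕ.≤ A × Markov A x y) →
           UniqueRealisation rr d n
  from-ℕ _ _ _ (_ , _ , _ , refl , refl , refl , 0<x , x+1<y , 3≤A , markov) = markov⇒uniqueRealisation 0<x x+1<y 3≤A markov

theorem4p20 :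
    (∀ (Δ t u : ℕ) → RealQuadDisc Δ → IsFundUnit Δ t u →
      ∀ (j m : ℕ) → + 0 < + j → + 0 < + m →
        (+ 0 < + r Δ t u j m)
        × (+ 2 * + r Δ t u j m < + dg Δ t u j m - + 1)
        × ((+ d₁ Δ t u j + + 1) * + r Δ t u j m * (+ dg Δ t u j m - + r Δ t u j m)
             ≡ + dg Δ t u j m * + dg Δ t u j m - + 1))
    ×
    (∀ (rr d n : ℤ) → + 0 < rr → + 2 * rr < d - + 1 → + 4 < n →
      n * rr * (d - rr) ≡ d * d - + 1 →
        Σ ℕ (λ Δ → Σ ℕ (λ t → Σ ℕ (λ u → Σ ℕ (λ j → Σ ℕ (λ m →
          (RealQuadDisc Δ × IsFundUnit Δ t u × + 0 < + j × + 0 < + m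
            × rr ≡ + r Δ t u j m × d ≡ + dg Δ t u j m × n ≡ + d₁ Δ t u j + + 1)
          × (∀ (Δ' t' u' j' m' : ℕ) → RealQuadDisc Δ' → IsFundUnit Δ' t' u' →
               + 0 < + j' → + 0 < + m' →
               rr ≡ + r Δ' t' u' j' m' → d ≡ + dg Δ' t' u' j' m' →
               n ≡ + d₁ Δ' t' u' j' + + 1 →
               Δ' ≡ Δ × j' ≡ j × m' ≡ m)))))))
theorem4p20 = partA , partB
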